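{- For integers $m>n\ge 0$, $\chi_{la}(Sp(2n+1,\,2m+1,\,4(m-n)-1))=4$.
   Context: All graphs are finite, simple and connected. For a graph $G=(V,E)$ with $q=|E|$ edges, a local antimagic labeling of $G$ is a bijection $f:E\to\{1,\dots,q\}$ such that $f^+(x)\ne f^+(y)$ for every pair of adjacent vertices $x,y$, where $f^+(x)=\sum_{e\ni x} f(e)$. The local antimagic chromatic number $\chi_{la}(G)$ is the minimum, over all local antimagic labelings $f$ of $G$, of the number of distinct values taken by $f^+$. For integers $y_1,y_2,y_3\ge 1$, the spider $Sp(y_1,y_2,y_3)$ is the tree obtained from three paths of lengths (numbers of edges) $y_1,y_2,y_3$ by identifying one end-vertex of each path into a single vertex (the core). -}

module Defs where

open import Data.Nat using (ℕ; zero; suc; _+_; _*_; _∸_; _≤_; _≟_)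
open import Data.Bool using (Bool; true; false; if_then_else_; _∨_)
open import Data.Nat using (_≡ᵇ_)
open import Data.List using (List; []; _∷_; map; upTo; length; zip; _++_; deduplicate)
open import Data.Nat.ListAction using (sum)
open import Data.List.Membership.Propositional using (_∈_)
open import Data.List.Relation.Binary.Permutation.Propositional using (_↭_)
open import Data.Product using (_×_; _,_; ∃-syntax)
open import Relation.Binary.PropositionalEquality using (_≡_; _≢_)

-- A (finite, simple) graph presented by its number of vertices (vertices are
-- 0 .. nv-1) and its list of edges (each edge a pair of endpoints).
record Graph : Set where
  constructor mkGraph
  field
    nv    : ℕ
    edges : List (ℕ × ℕ)
open Graph public

q : Graph → ℕ
q G = length (edges G)

-- A labeling assigns labels to edges, listed in the same order as 'edges G'.
-- It is a bijection E → {1,…,q} iff the label list is a permutation of [1..q].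
IsBijectiveLabeling : Graph → List ℕ → Set
IsBijectiveLabeling G ls = ls ↭ map suc (upTo (q G))

incident : ℕ → ℕ × ℕ → Bool
incident x (u , v) = (x ≡ᵇ u) ∨ (x ≡ᵇ v)

vsum : Graph → List ℕ → ℕ → ℕ
vsum G ls x = sum (map (λ { (e , l) → if incident x e then l else 0 }) (zip (edges G) ls))

IsLocalAntimagic : Graph → List ℕ → Set
IsLocalAntimagic G ls =
  IsBijectiveLabeling G ls ×
  (∀ u v → (u , v) ∈ edges G → vsum G ls u ≢ vsum G ls v)

numColors : Graph → List ℕ → ℕ
numColors G ls = length (deduplicate _≟_ (map (vsum G ls) (upTo (nv G))))

ChiLa : Graph → ℕ → Set
ChiLa G k =
  (∃[ ls ] (IsLocalAntimagic G ls × numColors G ls ≡ k)) ×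
  (∀ ls → IsLocalAntimagic G ls → k ≤ numColors G ls)

-- Spider Sp(a,b,c): core is vertex 0; leg with offset o and length y is the path
-- 0 — o+1 — o+2 — … — o+y.
legEdges : ℕ → ℕ → List (ℕ × ℕ)
legEdges o y = map (λ j → (prev j , o + suc j)) (upTo y)
  where
  prev : ℕ → ℕ
  prev zero    = 0
  prev (suc j) = o + suc j

spider : ℕ → ℕ → ℕ → Graph
spider a b c = mkGraph (1 + a + b + c) (legEdges 0 a ++ legEdges a b ++ legEdges (a + b) c)

-- Each pendant vertex has the label of its edge as
-- its sum, so the three pendant sums are distinct labels, while an end vertex of the edge labelled q
-- has a sum exceeding q: at least four colours occur. Conversely, label every leg from the core as
-- s, A − s, s + δ₁, A − s − δ₁, … with steps δᵢ ∈ {1, 2, J}, ending in a pendant label in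
-- {A, A+1, A+2}. The vertex sums along a leg then alternate between A and A + δᵢ, the core gets
-- A + J, and only the four colours A, A+1, A+2, A+J occur. If A = 2K+1, the legs take K steps in
-- total, the pendant labels are A, A+1, A+2, and every p ∈ {1, …, K} is an offset s + δ₁ + ⋯ or A
-- minus one, then the labels are exactly 1, …, A+2. Such offsets are arranged by one explicit family
-- of legs when n = 0 and by another, read in two leg orders, when n ≥ 1.
module Submission where

open import Data.Bool using (true; false; T; if_then_else_)
open import Data.Empty using (⊥-elim)
open import Data.List using (List; []; _∷_; _++_; map; zip; length; upTo; applyUpTo; replicate; deduplicate)
open import Data.List.Membership.Propositional using (_∈_)
open import Data.List.Membership.Propositional.Properties
  using (∈-++⁺ˡ; ∈-++⁺ʳ; ∈-++⁻; ∈-∃++; ∈-map⁺; ∈-map⁻; ∈-upTo⁺; ∈-upTo⁻; ∈-deduplicate⁺; ∈-deduplicate⁻)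
open import Data.List.Properties
  using (map-++; ++-assoc; map-applyUpTo; length-++; length-map; length-upTo; length-replicate)
open import Data.List.Relation.Binary.Permutation.Propositional
  using (_↭_; ↭-refl; ↭-sym; ↭-trans; ↭-prep; ↭⇒↭ₛ)
open import Data.List.Relation.Binary.Permutation.Propositional.Properties
  using (shift; ↭-length; ∈-resp-↭; ++-comm)
import Data.List.Relation.Binary.Permutation.Setoid.Properties as PermProperties
open import Data.List.Relation.Binary.Subset.Propositional using (_⊆_)
open import Data.List.Relation.Unary.All as All using (All; []; _∷_)
open import Data.List.Relation.Unary.All.Properties using () renaming (++⁺ to All-++⁺; replicate⁺ to All-replicate⁺)
open import Data.List.Relation.Unary.AllPairs using ([]; _∷_)
open import Data.List.Relation.Unary.Any using (here; there)
open import Data.List.Relation.Unary.Linked using (Linked; []; [-]; _∷_)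
open import Data.List.Relation.Unary.Linked.Properties using () renaming (map⁻ to Linked-map⁻)
open import Data.List.Relation.Unary.Unique.Propositional using (Unique)
open import Data.List.Relation.Unary.Unique.Propositional.Properties using (upTo⁺) renaming (map⁺ to Unique-map⁺)
open import Data.Nat using (ℕ; zero; suc; _+_; _*_; _∸_; _≤_; _<_; _≟_; _≤?_; _<?_; _≡ᵇ_; z≤n; s≤s; z<s)
open import Data.List.Relation.Unary.Unique.DecPropositional.Properties _≟_ using (deduplicate-!)
open import Data.Nat.ListAction using (sum)
open import Data.Nat.ListAction.Properties using (sum-++)
open import Data.Nat.Properties
open import Data.Nat.Tactic.RingSolver using (solve-∀)
open import Data.Product using (_×_; _,_; ∃-syntax; proj₁; proj₂)
open import Data.Sum using (_⊎_; inj₁; inj₂)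
open import Function using (_∘_; id)
open import Relation.Binary.PropositionalEquality hiding (J)
open import Relation.Nullary using (yes; no)

open import Defs

-- Vertex sums of a labelled spider

range : ℕ → ℕ → List ℕ
range v zero    = []
range v (suc y) = v ∷ range (suc v) y

applyUpTo≡range : ∀ (f : ℕ → ℕ) v y → (∀ j → f j ≡ v + j) → applyUpTo f y ≡ range v y
applyUpTo≡range f v zero    eq = refl
applyUpTo≡range f v (suc y) eq =
  cong₂ _∷_ (trans (eq 0) (+-identityʳ v))
    (applyUpTo≡range (f ∘ suc) (suc v) y (λ j → trans (eq (suc j)) (+-suc v j)))

upTo≡range : ∀ n → upTo n ≡ range 0 n
upTo≡range n = applyUpTo≡range id 0 n λ _ → refl

range-++ : ∀ v a b → range v (a + b) ≡ range v a ++ range (v + a) b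
range-++ v zero    b = cong (λ z → range z b) (sym (+-identityʳ v))
range-++ v (suc a) b =
  cong (v ∷_) (trans (range-++ (suc v) a b) (cong (λ z → range (suc v) a ++ range z b) (sym (+-suc v a))))

pathEdges : ℕ → ℕ → ℕ → List (ℕ × ℕ)
pathEdges u v y = zip (u ∷ range v y) (range v y)

length-pathEdges : ∀ u v y → length (pathEdges u v y) ≡ y
length-pathEdges u v zero    = refl
length-pathEdges u v (suc y) = cong suc (length-pathEdges v (suc v) y)

applyUpTo≡pathEdges : ∀ (h : ℕ → ℕ × ℕ) v y → (∀ j → h j ≡ (v + j , suc (v + j))) →
                      applyUpTo h y ≡ pathEdges v (suc v) y
applyUpTo≡pathEdges h v zero    eq = refl
applyUpTo≡pathEdges h v (suc y) eq =
  cong₂ _∷_ (trans (eq 0) (cong (λ z → z , suc z) (+-identityʳ v)))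
            (applyUpTo≡pathEdges (h ∘ suc) (suc v) y
              (λ j → trans (eq (suc j)) (cong (λ z → z , suc z) (+-suc v j))))

legEdges≡pathEdges : ∀ o y → legEdges o y ≡ pathEdges 0 (suc o) y
legEdges≡pathEdges o zero    = refl
legEdges≡pathEdges o (suc y) =
  cong₂ _∷_ (cong (0 ,_) (+-comm o 1))
    (trans (map-applyUpTo suc _ y)
      (applyUpTo≡pathEdges _ (suc o) y
        (λ j → cong₂ _,_ (+-suc o j) (trans (+-suc o (suc j)) (cong suc (+-suc o j))))))

q-spider : ∀ a b c → q (spider a b c) ≡ a + (b + c)
q-spider a b c = begin
  length (legEdges 0 a ++ legEdges a b ++ legEdges (a + b) c)
    ≡⟨ length-++ (legEdges 0 a) ⟩
  length (legEdges 0 a) + length (legEdges a b ++ legEdges (a + b) c)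
    ≡⟨ cong (length (legEdges 0 a) +_) (length-++ (legEdges a b)) ⟩
  length (legEdges 0 a) + (length (legEdges a b) + length (legEdges (a + b) c))
    ≡⟨ cong₂ _+_ (length-legEdges 0 a) (cong₂ _+_ (length-legEdges a b) (length-legEdges (a + b) c)) ⟩
  a + (b + c) ∎
  where
  open ≡-Reasoning
  length-legEdges : ∀ o y → length (legEdges o y) ≡ y
  length-legEdges o y = trans (cong length (legEdges≡pathEdges o y)) (length-pathEdges 0 (suc o) y)

incidentLabel : ℕ → (ℕ × ℕ) × ℕ → ℕ
incidentLabel x (e , l) = if incident x e then l else 0

pathVsum : ℕ → ℕ → List ℕ → ℕ → ℕ
pathVsum u v []      x = 0
pathVsum u v (l ∷ L) x = incidentLabel x ((u , v) , l) + pathVsum v (suc v) L x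

sum-incidentLabel-pathEdges : ∀ u v L x →
  sum (map (incidentLabel x) (zip (pathEdges u v (length L)) L)) ≡ pathVsum u v L x
sum-incidentLabel-pathEdges u v []      x = refl
sum-incidentLabel-pathEdges u v (l ∷ L) x =
  cong (incidentLabel x ((u , v) , l) +_) (sum-incidentLabel-pathEdges v (suc v) L x)

head₀ : List ℕ → ℕ
head₀ []      = 0
head₀ (x ∷ _) = x

-- f⁺ along the internal vertices and the end of a labelled path.
pathSums : List ℕ → List ℕ
pathSums []      = []
pathSums (l ∷ L) = l + head₀ L ∷ pathSums L

≢⇒≡ᵇ-false : ∀ {x y} → x ≢ y → (x ≡ᵇ y) ≡ false
≢⇒≡ᵇ-false {x} {y} x≢y with x ≡ᵇ y in eq
... | false = refl
... | true  = ⊥-elim (x≢y (≡ᵇ⇒≡ x y (subst T (sym eq) _)))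

≡ᵇ-refl : ∀ x → (x ≡ᵇ x) ≡ true
≡ᵇ-refl zero    = refl
≡ᵇ-refl (suc x) = ≡ᵇ-refl x

incident-other : ∀ {x u v} → x ≢ u → x ≢ v → incident x (u , v) ≡ false
incident-other x≢u x≢v rewrite ≢⇒≡ᵇ-false x≢u | ≢⇒≡ᵇ-false x≢v = refl

incident-left : ∀ u v → incident u (u , v) ≡ true
incident-left u v rewrite ≡ᵇ-refl u = refl

incident-right : ∀ {u v} → v ≢ u → incident v (u , v) ≡ true
incident-right {u} {v} v≢u rewrite ≢⇒≡ᵇ-false v≢u | ≡ᵇ-refl v = refl

pathVsum-below : ∀ u v L x → x ≢ u → x < v → pathVsum u v L x ≡ 0
pathVsum-below u v []      x x≢u x<v = refl
pathVsum-below u v (l ∷ L) x x≢u x<v rewrite incident-other x≢u (<⇒≢ x<v) =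
  pathVsum-below v (suc v) L x (<⇒≢ x<v) (m<n⇒m<1+n x<v)

pathVsum-above : ∀ u v L x → x ≢ u → v + length L ≤ x → pathVsum u v L x ≡ 0
pathVsum-above u v []      x x≢u v+L≤x = refl
pathVsum-above u v (l ∷ L) x x≢u v+L≤x with <-≤-trans (m<m+n v z<s) v+L≤x
... | v<x rewrite incident-other x≢u (≢-sym (<⇒≢ v<x)) =
  pathVsum-above v (suc v) L x (≢-sym (<⇒≢ v<x)) (subst (_≤ x) (+-suc v (length L)) v+L≤x)

pathVsum-start : ∀ u v L → u < v → pathVsum u v L u ≡ head₀ L
pathVsum-start u v []      u<v = refl
pathVsum-start u v (l ∷ L) u<v
  rewrite incident-left u v | pathVsum-below v (suc v) L u (<⇒≢ u<v) (m<n⇒m<1+n u<v) = +-identityʳ l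

map-cong-range : ∀ (f g : ℕ → ℕ) v y → (∀ x → v ≤ x → x < v + y → f x ≡ g x) →
                 map f (range v y) ≡ map g (range v y)
map-cong-range f g v zero    eq = refl
map-cong-range f g v (suc y) eq =
  cong₂ _∷_ (eq v ≤-refl (m<m+n v z<s))
    (map-cong-range f g (suc v) y (λ x v<x x< → eq x (<⇒≤ v<x) (subst (x <_) (sym (+-suc v y)) x<)))

pathVsum-range : ∀ u v L → u < v → map (pathVsum u v L) (range v (length L)) ≡ pathSums L
pathVsum-range u v []      u<v = refl
pathVsum-range u v (l ∷ L) u<v =
  cong₂ _∷_ at-v (trans beyond-v (pathVsum-range v (suc v) L (n<1+n v)))
  where
  at-v : pathVsum u v (l ∷ L) v ≡ l + head₀ L
  at-v rewrite incident-right {u} {v} (≢-sym (<⇒≢ u<v)) = cong (l +_) (pathVsum-start v (suc v) L (n<1+n v))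
  beyond-v : map (pathVsum u v (l ∷ L)) (range (suc v) (length L))
             ≡ map (pathVsum v (suc v) L) (range (suc v) (length L))
  beyond-v = map-cong-range _ _ (suc v) (length L) λ x v<x _ →
    cong (λ b → (if b then l else 0) + pathVsum v (suc v) L x)
      (incident-other (≢-sym (<⇒≢ (<-trans u<v v<x))) (≢-sym (<⇒≢ v<x)))

zip-++ : ∀ {A B : Set} (xs xs′ : List A) (ys ys′ : List B) → length xs ≡ length ys →
         zip (xs ++ xs′) (ys ++ ys′) ≡ zip xs ys ++ zip xs′ ys′
zip-++ []       xs′ []       ys′ _  = refl
zip-++ (x ∷ xs) xs′ (y ∷ ys) ys′ eq = cong ((x , y) ∷_) (zip-++ xs xs′ ys ys′ (suc-injective eq))

sum-map-zip-++ : ∀ (f : (ℕ × ℕ) × ℕ → ℕ) E E′ L L′ → length E ≡ length L →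
  sum (map f (zip (E ++ E′) (L ++ L′))) ≡ sum (map f (zip E L)) + sum (map f (zip E′ L′))
sum-map-zip-++ f E E′ L L′ eq = begin
  sum (map f (zip (E ++ E′) (L ++ L′)))         ≡⟨ cong (sum ∘ map f) (zip-++ E E′ L L′ eq) ⟩
  sum (map f (zip E L ++ zip E′ L′))             ≡⟨ cong sum (map-++ f (zip E L) _) ⟩
  sum (map f (zip E L) ++ map f (zip E′ L′))     ≡⟨ sum-++ (map f (zip E L)) _ ⟩
  sum (map f (zip E L)) + sum (map f (zip E′ L′)) ∎
  where open ≡-Reasoning

spiderOf : List ℕ → List ℕ → List ℕ → Graph
spiderOf La Lb Lc = spider (length La) (length Lb) (length Lc)

vsum-spider : ∀ La Lb Lc x → vsum (spiderOf La Lb Lc) (La ++ Lb ++ Lc) x ≡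
  pathVsum 0 1 La x + (pathVsum 0 (suc (length La)) Lb x + pathVsum 0 (suc (length La + length Lb)) Lc x)
vsum-spider La Lb Lc x = begin
  sum (map f (zip (legEdges 0 a ++ legEdges a b ++ legEdges (a + b) c) (La ++ Lb ++ Lc)))
    ≡⟨ cong (λ E → sum (map f (zip E (La ++ Lb ++ Lc))))
         (cong₂ _++_ (legEdges≡pathEdges 0 a)
           (cong₂ _++_ (legEdges≡pathEdges a b) (legEdges≡pathEdges (a + b) c))) ⟩
  sum (map f (zip (Ea ++ Eb ++ Ec) (La ++ Lb ++ Lc)))
    ≡⟨ sum-map-zip-++ f Ea (Eb ++ Ec) La (Lb ++ Lc) (length-pathEdges 0 1 a) ⟩
  sum (map f (zip Ea La)) + sum (map f (zip (Eb ++ Ec) (Lb ++ Lc)))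
    ≡⟨ cong (sum (map f (zip Ea La)) +_) (sum-map-zip-++ f Eb Ec Lb Lc (length-pathEdges 0 (suc a) b)) ⟩
  sum (map f (zip Ea La)) + (sum (map f (zip Eb Lb)) + sum (map f (zip Ec Lc)))
    ≡⟨ cong₂ _+_ (sum-incidentLabel-pathEdges 0 1 La x)
         (cong₂ _+_ (sum-incidentLabel-pathEdges 0 (suc a) Lb x) (sum-incidentLabel-pathEdges 0 (suc (a + b)) Lc x)) ⟩
  pathVsum 0 1 La x + (pathVsum 0 (suc a) Lb x + pathVsum 0 (suc (a + b)) Lc x) ∎
  where
  open ≡-Reasoning
  f = incidentLabel x
  a = length La
  b = length Lb
  c = length Lc
  Ea = pathEdges 0 1 a
  Eb = pathEdges 0 (suc a) b
  Ec = pathEdges 0 (suc (a + b)) c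

Linked-pathEdges : ∀ {R : ℕ → ℕ → Set} {u v} y {x w} →
  Linked R (u ∷ range v y) → (x , w) ∈ pathEdges u v y → R x w
Linked-pathEdges (suc y) (Ruv ∷ _)    (here refl) = Ruv
Linked-pathEdges (suc y) (_   ∷ Rvws) (there xw)  = Linked-pathEdges y Rvws xw

leg-adjacent : ∀ (f : ℕ → ℕ) X v L → map f (0 ∷ range v (length L)) ≡ X ∷ pathSums L →
  Linked _≢_ (X ∷ pathSums L) → ∀ {x w} → (x , w) ∈ pathEdges 0 v (length L) → f x ≢ f w
leg-adjacent f X v L sums proper =
  Linked-pathEdges (length L) (Linked-map⁻ (subst (Linked _≢_) (sym sums) proper))

coreSum : List ℕ → List ℕ → List ℕ → ℕ
coreSum La Lb Lc = head₀ La + (head₀ Lb + head₀ Lc)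

module _ (La Lb Lc : List ℕ) where
  private
    a = length La
    b = length Lb
    f = vsum (spiderOf La Lb Lc) (La ++ Lb ++ Lc)

    positive⇒≢0 : ∀ {x y} → 0 < y → y ≤ x → x ≢ 0
    positive⇒≢0 0<y y≤x = ≢-sym (<⇒≢ (<-≤-trans 0<y y≤x))

  vsum-core : f 0 ≡ coreSum La Lb Lc
  vsum-core = trans (vsum-spider La Lb Lc 0)
    (cong₂ _+_ (pathVsum-start 0 1 La z<s)
      (cong₂ _+_ (pathVsum-start 0 (suc a) Lb z<s) (pathVsum-start 0 (suc (a + b)) Lc z<s)))

  vsum-legᵃ : map f (range 1 a) ≡ pathSums La
  vsum-legᵃ = trans (map-cong-range f (pathVsum 0 1 La) 1 a λ x 1≤x x<1+a →
      trans (vsum-spider La Lb Lc x)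
        (trans (cong (pathVsum 0 1 La x +_)
                 (cong₂ _+_ (pathVsum-below 0 (suc a) Lb x (positive⇒≢0 z<s 1≤x) x<1+a)
                            (pathVsum-below 0 (suc (a + b)) Lc x (positive⇒≢0 z<s 1≤x)
                              (≤-trans x<1+a (s≤s (m≤m+n a b))))))
          (+-identityʳ _)))
    (pathVsum-range 0 1 La z<s)

  vsum-legᵇ : map f (range (suc a) b) ≡ pathSums Lb
  vsum-legᵇ = trans (map-cong-range f (pathVsum 0 (suc a) Lb) (suc a) b λ x 1+a≤x x<1+a+b →
      trans (vsum-spider La Lb Lc x)
        (cong₂ _+_ (pathVsum-above 0 1 La x (positive⇒≢0 z<s 1+a≤x) 1+a≤x)
          (trans (cong (pathVsum 0 (suc a) Lb x +_)
                   (pathVsum-below 0 (suc (a + b)) Lc x (positive⇒≢0 z<s 1+a≤x) x<1+a+b))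
            (+-identityʳ _))))
    (pathVsum-range 0 (suc a) Lb z<s)

  vsum-legᶜ : map f (range (suc (a + b)) (length Lc)) ≡ pathSums Lc
  vsum-legᶜ = trans (map-cong-range f (pathVsum 0 (suc (a + b)) Lc) (suc (a + b)) (length Lc) λ x 1+a+b≤x _ →
      trans (vsum-spider La Lb Lc x)
        (cong₂ _+_ (pathVsum-above 0 1 La x (positive⇒≢0 z<s 1+a+b≤x) (≤-trans (s≤s (m≤m+n a b)) 1+a+b≤x))
          (cong (_+ pathVsum 0 (suc (a + b)) Lc x)
            (pathVsum-above 0 (suc a) Lb x (positive⇒≢0 z<s 1+a+b≤x) 1+a+b≤x))))
    (pathVsum-range 0 (suc (a + b)) Lc z<s)

  vsum-spider-adjacent : let X = coreSum La Lb Lc in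
    Linked _≢_ (X ∷ pathSums La) → Linked _≢_ (X ∷ pathSums Lb) → Linked _≢_ (X ∷ pathSums Lc) →
    ∀ u v → (u , v) ∈ edges (spiderOf La Lb Lc) → f u ≢ f v
  vsum-spider-adjacent properᵃ properᵇ properᶜ u v uv with ∈-++⁻ (legEdges 0 a) uv
  ... | inj₁ uvᵃ = leg-adjacent f _ 1 La (cong₂ _∷_ vsum-core vsum-legᵃ) properᵃ
                     (subst ((u , v) ∈_) (legEdges≡pathEdges 0 a) uvᵃ)
  ... | inj₂ uvᵇᶜ with ∈-++⁻ (legEdges a b) uvᵇᶜ
  ...   | inj₁ uvᵇ = leg-adjacent f _ (suc a) Lb (cong₂ _∷_ vsum-core vsum-legᵇ) properᵇ
                       (subst ((u , v) ∈_) (legEdges≡pathEdges a b) uvᵇ)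
  ...   | inj₂ uvᶜ = leg-adjacent f _ (suc (a + b)) Lc (cong₂ _∷_ vsum-core vsum-legᶜ) properᶜ
                       (subst ((u , v) ∈_) (legEdges≡pathEdges (a + b) (length Lc)) uvᶜ)

spiderSums : List ℕ → List ℕ → List ℕ → List ℕ
spiderSums La Lb Lc = coreSum La Lb Lc ∷ (pathSums La ++ pathSums Lb ++ pathSums Lc)

vsums-spider : ∀ La Lb Lc → let G = spiderOf La Lb Lc in
  map (vsum G (La ++ Lb ++ Lc)) (upTo (nv G)) ≡ spiderSums La Lb Lc
vsums-spider La Lb Lc = begin
  map f (upTo (suc ((a + b) + c)))
    ≡⟨ cong (map f) (upTo≡range (suc ((a + b) + c))) ⟩
  f 0 ∷ map f (range 1 ((a + b) + c))
    ≡⟨ cong (λ r → f 0 ∷ map f r) (trans (range-++ 1 (a + b) c)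
         (trans (cong (_++ range (suc (a + b)) c) (range-++ 1 a b)) (++-assoc (range 1 a) _ _))) ⟩
  f 0 ∷ map f (range 1 a ++ range (suc a) b ++ range (suc (a + b)) c)
    ≡⟨ cong (f 0 ∷_) (trans (map-++ f (range 1 a) _)
         (cong (map f (range 1 a) ++_) (map-++ f (range (suc a) b) _))) ⟩
  f 0 ∷ (map f (range 1 a) ++ map f (range (suc a) b) ++ map f (range (suc (a + b)) c))
    ≡⟨ cong₂ _∷_ (vsum-core La Lb Lc)
         (cong₂ _++_ (vsum-legᵃ La Lb Lc) (cong₂ _++_ (vsum-legᵇ La Lb Lc) (vsum-legᶜ La Lb Lc))) ⟩
  spiderSums La Lb Lc ∎
  where
  open ≡-Reasoning
  a = length La
  b = length Lb
  c = length Lc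
  f = vsum (spiderOf La Lb Lc) (La ++ Lb ++ Lc)

Unique-resp-↭ : ∀ {xs ys : List ℕ} → xs ↭ ys → Unique xs → Unique ys
Unique-resp-↭ p = PermProperties.Unique-resp-↭ (setoid ℕ) (↭⇒↭ₛ p)

∈⇒↭∷ : ∀ {x : ℕ} {xs} → x ∈ xs → ∃[ r ] xs ↭ x ∷ r × (∀ {z} → z ∈ xs → z ≢ x → z ∈ r)
∈⇒↭∷ {x} x∈xs with ∈-∃++ x∈xs
... | pre , post , refl = pre ++ post , shift x pre post , keep
  where
  keep : ∀ {z} → z ∈ pre ++ x ∷ post → z ≢ x → z ∈ pre ++ post
  keep z∈ z≢x with ∈-++⁻ pre z∈
  ... | inj₁ z∈pre          = ∈-++⁺ˡ z∈pre
  ... | inj₂ (here z≡x)     = ⊥-elim (z≢x z≡x)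
  ... | inj₂ (there z∈post) = ∈-++⁺ʳ pre z∈post

⊆-++₃ˡ : ∀ {xs} ys {zs : List ℕ} → xs ⊆ xs ++ ys ++ zs
⊆-++₃ˡ ys = ∈-++⁺ˡ

⊆-++₃ᵐ : ∀ xs {ys zs : List ℕ} → ys ⊆ xs ++ ys ++ zs
⊆-++₃ᵐ xs = ∈-++⁺ʳ xs ∘ ∈-++⁺ˡ

⊆-++₃ʳ : ∀ xs ys {zs : List ℕ} → zs ⊆ xs ++ ys ++ zs
⊆-++₃ʳ xs ys = ∈-++⁺ʳ xs ∘ ∈-++⁺ʳ ys

Unique-⊆⇒length≤ : ∀ (ys xs : List ℕ) → Unique ys → ys ⊆ xs → length ys ≤ length xs
Unique-⊆⇒length≤ []       xs _          _    = z≤n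
Unique-⊆⇒length≤ (y ∷ ys) xs (y∉ys ∷ ys!) ys⊆xs with ∈⇒↭∷ (ys⊆xs (here refl))
... | r , xs↭y∷r , keep = subst (suc (length ys) ≤_) (sym (↭-length xs↭y∷r))
  (s≤s (Unique-⊆⇒length≤ ys r ys! λ z∈ys → keep (ys⊆xs (there z∈ys)) (≢-sym (All.lookup y∉ys z∈ys))))

Unique-⊆⇒↭ : ∀ (ys xs : List ℕ) → Unique ys → ys ⊆ xs → length xs ≤ length ys → xs ↭ ys
Unique-⊆⇒↭ []       []       _            _     _  = ↭-refl
Unique-⊆⇒↭ (y ∷ ys) xs       (y∉ys ∷ ys!) ys⊆xs xs≤ with ∈⇒↭∷ (ys⊆xs (here refl))
... | r , xs↭y∷r , keep = ↭-trans xs↭y∷r (↭-prep y (Unique-⊆⇒↭ ys r ys!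
  (λ z∈ys → keep (ys⊆xs (there z∈ys)) (≢-sym (All.lookup y∉ys z∈ys)))
  (≤-pred (subst (_≤ suc (length ys)) (↭-length xs↭y∷r) xs≤))))

Unique-++⇒≢ : ∀ (xs ys : List ℕ) → Unique (xs ++ ys) → ∀ {x y} → x ∈ xs → y ∈ ys → x ≢ y
Unique-++⇒≢ (x ∷ xs) ys (x∉ ∷ _)   (here refl) y∈ys = All.lookup x∉ (∈-++⁺ʳ xs y∈ys)
Unique-++⇒≢ (_ ∷ xs) ys (_ ∷ xs!) (there x∈xs) y∈ys = Unique-++⇒≢ xs ys xs! x∈xs y∈ys

Unique-upTo+1 : ∀ Q → Unique (map suc (upTo Q))
Unique-upTo+1 Q = Unique-map⁺ suc-injective (upTo⁺ Q)

∈-labels⁻ : ∀ {z} Q → z ∈ map suc (upTo Q) → 1 ≤ z × z ≤ Q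
∈-labels⁻ Q z∈ with ∈-map⁻ suc z∈
... | i , i∈ , refl = s≤s z≤n , ∈-upTo⁻ i∈

∈-labels⁺ : ∀ {z} Q → 1 ≤ z → z ≤ Q → z ∈ map suc (upTo Q)
∈-labels⁺ {suc i} Q _ i<Q = ∈-map⁺ suc (∈-upTo⁺ i<Q)

-- At least four colours

last∈pathSums : ∀ L → 0 < length L → ∃[ l ] l ∈ L × l ∈ pathSums L
last∈pathSums (l ∷ [])     _ = l , here refl , here (sym (+-identityʳ l))
last∈pathSums (l ∷ l′ ∷ L) _ with last∈pathSums (l′ ∷ L) z<s
... | x , x∈L , x∈sums = x , there x∈L , there x∈sums

head₀∈ : ∀ L → 0 < length L → head₀ L ∈ L
head₀∈ (l ∷ L) _ = here refl

pathSums-exceed₂ : ∀ Q l l′ L → Q ∈ l ∷ l′ ∷ L → All (1 ≤_) (l ∷ l′ ∷ L) → ∃[ y ] y ∈ pathSums (l ∷ l′ ∷ L) × Q < y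
pathSums-exceed₂ Q l l′ L        (here refl)         (_ ∷ 1≤l′ ∷ _) =
  Q + l′ , here refl , subst (_≤ Q + l′) (+-comm Q 1) (+-monoʳ-≤ Q 1≤l′)
pathSums-exceed₂ Q l l′ []       (there (here refl)) (1≤l ∷ _)      = l + Q , here refl , +-monoˡ-≤ Q 1≤l
pathSums-exceed₂ Q l l′ (l″ ∷ L) (there Q∈)          (_ ∷ positive) with pathSums-exceed₂ Q l′ l″ L Q∈ positive
... | y , y∈ , Q<y = y , there y∈ , Q<y

pathSums-exceed : ∀ Q L → Q ∈ L → All (1 ≤_) L → (∃[ y ] y ∈ pathSums L × Q < y) ⊎ head₀ L ≡ Q
pathSums-exceed Q (l ∷ [])     (here refl) _        = inj₂ refl
pathSums-exceed Q (l ∷ l′ ∷ L) Q∈          positive = inj₁ (pathSums-exceed₂ Q l l′ L Q∈ positive)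

Unique-++₃ : ∀ (xs ys zs : List ℕ) → Unique (xs ++ ys ++ zs) →
             ∀ {x y z} → x ∈ xs → y ∈ ys → z ∈ zs → Unique (x ∷ y ∷ z ∷ [])
Unique-++₃ xs ys zs xyz! x∈ y∈ z∈ =
  (Unique-++⇒≢ xs (ys ++ zs) xyz! x∈ (∈-++⁺ˡ y∈) ∷ Unique-++⇒≢ xs (ys ++ zs) xyz! x∈ (∈-++⁺ʳ ys z∈) ∷ [])
  ∷ (Unique-++⇒≢ (xs ++ ys) zs (subst Unique (sym (++-assoc xs ys zs)) xyz!) (∈-++⁺ʳ xs y∈) z∈ ∷ [])
  ∷ [] ∷ []

module _ (La Lb Lc : List ℕ) where
  spiderSums-exceed : ∀ Q → 0 < length Lb → 0 < length Lc →
    All (1 ≤_) La → All (1 ≤_) Lb → All (1 ≤_) Lc → Q ∈ La ++ Lb ++ Lc → ∃[ y ] y ∈ spiderSums La Lb Lc × Q < y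
  spiderSums-exceed Q 0<b 0<c posᵃ posᵇ posᶜ Q∈ with ∈-++⁻ La Q∈
  ... | inj₁ Q∈a with pathSums-exceed Q La Q∈a posᵃ
  ...   | inj₁ (y , y∈ , Q<y) = y , there (⊆-++₃ˡ (pathSums Lb) y∈) , Q<y
  ...   | inj₂ refl = _ , here refl ,
          m<m+n (head₀ La) (≤-trans (All.lookup posᵇ (head₀∈ Lb 0<b)) (m≤m+n (head₀ Lb) (head₀ Lc)))
  spiderSums-exceed Q 0<b 0<c posᵃ posᵇ posᶜ Q∈ | inj₂ Q∈bc with ∈-++⁻ Lb Q∈bc
  ... | inj₁ Q∈b with pathSums-exceed Q Lb Q∈b posᵇ
  ...   | inj₁ (y , y∈ , Q<y) = y , there (⊆-++₃ᵐ (pathSums La) y∈) , Q<y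
  ...   | inj₂ refl = _ , here refl ,
          <-≤-trans (m<m+n (head₀ Lb) (All.lookup posᶜ (head₀∈ Lc 0<c))) (m≤n+m _ (head₀ La))
  spiderSums-exceed Q 0<b 0<c posᵃ posᵇ posᶜ Q∈ | inj₂ Q∈bc | inj₂ Q∈c with pathSums-exceed Q Lc Q∈c posᶜ
  ...   | inj₁ (y , y∈ , Q<y) = y , there (⊆-++₃ʳ (pathSums La) (pathSums Lb) y∈) , Q<y
  ...   | inj₂ refl = _ , here refl ,
          <-≤-trans (m<n+m (head₀ Lc) (All.lookup posᵇ (head₀∈ Lb 0<b))) (m≤n+m _ (head₀ La))

  -- The three pendant labels are distinct colours, all smaller than a colour exceeding Q.
  spiderSums-colours≥4 : ∀ Q → 0 < length La → 0 < length Lb → 0 < length Lc →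
    Unique (La ++ Lb ++ Lc) → (∀ {z} → z ∈ La ++ Lb ++ Lc → 1 ≤ z × z ≤ Q) → Q ∈ La ++ Lb ++ Lc →
    4 ≤ length (deduplicate _≟_ (spiderSums La Lb Lc))
  spiderSums-colours≥4 Q 0<a 0<b 0<c ls! bounds Q∈
    with last∈pathSums La 0<a | last∈pathSums Lb 0<b | last∈pathSums Lc 0<c
       | spiderSums-exceed Q 0<b 0<c (All.tabulate (proj₁ ∘ bounds ∘ ⊆-++₃ˡ Lb))
           (All.tabulate (proj₁ ∘ bounds ∘ ⊆-++₃ᵐ La)) (All.tabulate (proj₁ ∘ bounds ∘ ⊆-++₃ʳ La Lb)) Q∈
  ... | la , la∈La , la∈Pa | lb , lb∈Lb , lb∈Pb | lc , lc∈Lc , lc∈Pc | y , y∈S , Q<y =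
    Unique-⊆⇒length≤ (y ∷ la ∷ lb ∷ lc ∷ []) (deduplicate _≟_ (spiderSums La Lb Lc))
      ((above (⊆-++₃ˡ Lb la∈La) ∷ above (⊆-++₃ᵐ La lb∈Lb) ∷ above (⊆-++₃ʳ La Lb lc∈Lc) ∷ [])
        ∷ Unique-++₃ La Lb Lc ls! la∈La lb∈Lb lc∈Lc)
      (λ { (here refl)                         → ∈-deduplicate⁺ _≟_ y∈S
         ; (there (here refl))                 → ∈-deduplicate⁺ _≟_ (there (⊆-++₃ˡ (pathSums Lb) la∈Pa))
         ; (there (there (here refl)))         → ∈-deduplicate⁺ _≟_ (there (⊆-++₃ᵐ (pathSums La) lb∈Pb))
         ; (there (there (there (here refl)))) →
             ∈-deduplicate⁺ _≟_ (there (⊆-++₃ʳ (pathSums La) (pathSums Lb) lc∈Pc)) })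
    where
    above : ∀ {z} → z ∈ La ++ Lb ++ Lc → y ≢ z
    above z∈ = ≢-sym (<⇒≢ (≤-<-trans (proj₂ (bounds z∈)) Q<y))

split-++ : ∀ a (ls : List ℕ) r → length ls ≡ a + r →
           ∃[ xs ] ∃[ ys ] ls ≡ xs ++ ys × length xs ≡ a × length ys ≡ r
split-++ zero    ls       r eq = [] , ls , refl , refl , eq
split-++ (suc a) (x ∷ ls) r eq with split-++ a ls r (suc-injective eq)
... | xs , ys , refl , refl , refl = x ∷ xs , ys , refl , refl , refl

numColors-spider≥4 : ∀ a b c → 0 < a → 0 < b → 0 < c →
  ∀ ls → IsLocalAntimagic (spider a b c) ls → 4 ≤ numColors (spider a b c) ls
numColors-spider≥4 a b c 0<a 0<b 0<c ls (labels↭ , _)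
  with split-++ a ls (b + c) (trans (↭-length labels↭) length-labels)
  where
  length-labels : length (map suc (upTo (q (spider a b c)))) ≡ a + (b + c)
  length-labels = trans (length-map suc (upTo (q (spider a b c))))
                    (trans (length-upTo (q (spider a b c))) (q-spider a b c))
... | La , rest , refl , refl , length-rest with split-++ b rest c length-rest
... | Lb , Lc , refl , refl , refl =
  subst (λ S → 4 ≤ length (deduplicate _≟_ S)) (sym (vsums-spider La Lb Lc))
    (spiderSums-colours≥4 La Lb Lc Q 0<a 0<b 0<c
      (Unique-resp-↭ (↭-sym labels↭′) (Unique-upTo+1 Q)) bounds Q∈)
  where
  Q = a + (b + c)
  labels↭′ : (La ++ Lb ++ Lc) ↭ map suc (upTo Q)
  labels↭′ = subst (λ Q → (La ++ Lb ++ Lc) ↭ map suc (upTo Q)) (q-spider a b c) labels↭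
  bounds : ∀ {z} → z ∈ La ++ Lb ++ Lc → 1 ≤ z × z ≤ Q
  bounds z∈ = ∈-labels⁻ Q (∈-resp-↭ labels↭′ z∈)
  Q∈ : Q ∈ La ++ Lb ++ Lc
  Q∈ = ∈-resp-↭ (↭-sym labels↭′) (∈-labels⁺ Q (≤-trans 0<a (m≤m+n a (b + c))) ≤-refl)

-- Alternating legs

altLabels : ℕ → ℕ → List ℕ → List ℕ
altLabels A s []       = s ∷ []
altLabels A s (δ ∷ δs) = s ∷ A ∸ s ∷ altLabels A (s + δ) δs

offsets : ℕ → List ℕ → List ℕ
offsets s []       = []
offsets s (δ ∷ δs) = s ∷ offsets (s + δ) δs

pendant : ℕ → List ℕ → ℕ
pendant s δs = s + sum δs

lastStep : List ℕ → ℕ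
lastStep []           = 0
lastStep (δ ∷ [])     = δ
lastStep (_ ∷ δ ∷ δs) = lastStep (δ ∷ δs)

altSums : ℕ → ℕ → List ℕ → List ℕ
altSums A s []       = s ∷ []
altSums A s (δ ∷ δs) = A ∷ A + δ ∷ altSums A (s + δ) δs

head₀-altLabels : ∀ A s δs → head₀ (altLabels A s δs) ≡ s
head₀-altLabels A s []      = refl
head₀-altLabels A s (_ ∷ _) = refl

pathSums-altLabels : ∀ A s δs → All (_< A) (offsets s δs) → pathSums (altLabels A s δs) ≡ altSums A s δs
pathSums-altLabels A s []       _            = cong (_∷ []) (+-identityʳ s)
pathSums-altLabels A s (δ ∷ δs) (s<A ∷ o<A) = cong₂ _∷_ (m+[n∸m]≡n (<⇒≤ s<A)) (cong₂ _∷_ (begin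
  A ∸ s + head₀ (altLabels A (s + δ) δs) ≡⟨ cong (A ∸ s +_) (head₀-altLabels A (s + δ) δs) ⟩
  A ∸ s + (s + δ)                        ≡⟨ +-assoc (A ∸ s) s δ ⟨
  A ∸ s + s + δ                          ≡⟨ cong (_+ δ) (m∸n+n≡m (<⇒≤ s<A)) ⟩
  A + δ                                  ∎)
  (pathSums-altLabels A (s + δ) δs o<A))
  where open ≡-Reasoning

lastStep≤sum : ∀ δs → lastStep δs ≤ sum δs
lastStep≤sum []           = z≤n
lastStep≤sum (δ ∷ [])     = m≤m+n δ 0
lastStep≤sum (δ ∷ δ′ ∷ δs) = ≤-trans (lastStep≤sum (δ′ ∷ δs)) (m≤n+m _ δ)

offsets+lastStep≤pendant : ∀ s δs → All (λ o → o + lastStep δs ≤ pendant s δs) (offsets s δs)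
offsets+lastStep≤pendant s []            = []
offsets+lastStep≤pendant s (δ ∷ [])      = +-monoʳ-≤ s (m≤m+n δ 0) ∷ []
offsets+lastStep≤pendant s (δ ∷ δ′ ∷ δs) =
  +-monoʳ-≤ s (≤-trans (lastStep≤sum (δ′ ∷ δs)) (m≤n+m _ δ)) ∷
  All.map (λ {o} → subst (o + lastStep (δ′ ∷ δs) ≤_) (+-assoc s δ (δ′ + sum δs)))
    (offsets+lastStep≤pendant (s + δ) (δ′ ∷ δs))

pendant<⇒offsets< : ∀ A s δs → pendant s δs < A + lastStep δs → All (_< A) (offsets s δs)
pendant<⇒offsets< A s δs p< =
  All.map (λ {o} o+≤ → +-cancelʳ-< (lastStep δs) o A (≤-<-trans o+≤ p<)) (offsets+lastStep≤pendant s δs)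

allowedSteps : ℕ → List ℕ
allowedSteps J = 1 ∷ 2 ∷ J ∷ []

pendantColours : ℕ → List ℕ
pendantColours A = A ∷ A + 1 ∷ A + 2 ∷ []

colours : ℕ → ℕ → List ℕ
colours A J = pendantColours A ++ A + J ∷ []

record ProperLeg (A J s : ℕ) (δs : List ℕ) : Set where
  field
    steps-valid   : All (_∈ allowedSteps J) δs
    offsets-below : All (_< A) (offsets s δs)
    pendant-valid : pendant s δs ∈ pendantColours A

pendant-∷ : ∀ s δ δs → pendant (s + δ) δs ≡ pendant s (δ ∷ δs)
pendant-∷ s δ δs = +-assoc s δ (sum δs)

step-positive : ∀ {J δ} → 1 ≤ J → δ ∈ allowedSteps J → 1 ≤ δ
step-positive _   (here refl)                 = s≤s z≤n
step-positive _   (there (here refl))         = s≤s z≤n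
step-positive 1≤J (there (there (here refl))) = 1≤J

A+J≢pendantColour : ∀ {A J v} → 3 ≤ J → v ∈ pendantColours A → A + J ≢ v
A+J≢pendantColour {A} {J} 3≤J v∈ A+J≡v with v∈
... | here refl                 =
  <⇒≢ (<-≤-trans z<s 3≤J) (sym (+-cancelˡ-≡ A J 0 (trans A+J≡v (sym (+-identityʳ A)))))
... | there (here refl)         = <⇒≢ (<-≤-trans (s≤s (s≤s z≤n)) 3≤J) (sym (+-cancelˡ-≡ A J 1 A+J≡v))
... | there (there (here refl)) = <⇒≢ 3≤J (sym (+-cancelˡ-≡ A J 2 A+J≡v))

altSums-colours : ∀ A J s δs → All (_∈ allowedSteps J) δs → pendant s δs ∈ pendantColours A →
                  All (_∈ colours A J) (altSums A s δs)
altSums-colours A J s []       _            p∈ =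
  ∈-++⁺ˡ (subst (_∈ pendantColours A) (+-identityʳ s) p∈) ∷ []
altSums-colours A J s (δ ∷ δs) (δ∈ ∷ δs∈) p∈ =
  here refl ∷ there (∈-map⁺ (A +_) δ∈) ∷ altSums-colours A J (s + δ) δs δs∈
    (subst (_∈ pendantColours A) (sym (pendant-∷ s δ δs)) p∈)

Linked-altSums : ∀ A s δs → All (1 ≤_) δs → All (_< A) (offsets s δs) → Linked _≢_ (altSums A s δs)
Linked-altSums A s []            _              _              = [-]
Linked-altSums A s (δ ∷ [])      (1≤δ ∷ _)      (s<A ∷ _)      =
  <⇒≢ (m<m+n A 1≤δ) ∷ (λ A+δ≡s+δ → <⇒≢ s<A (sym (+-cancelʳ-≡ δ A s A+δ≡s+δ))) ∷ [-]
Linked-altSums A s (δ ∷ δ′ ∷ δs) (1≤δ ∷ 1≤δs) (s<A ∷ o<A) =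
  <⇒≢ (m<m+n A 1≤δ) ∷ ≢-sym (<⇒≢ (m<m+n A 1≤δ)) ∷ Linked-altSums A (s + δ) (δ′ ∷ δs) 1≤δs o<A

module _ {A J s δs} (3≤J : 3 ≤ J) (proper : ProperLeg A J s δs) where
  open ProperLeg proper

  Linked-core-altLabels : Linked _≢_ (A + J ∷ pathSums (altLabels A s δs))
  Linked-core-altLabels = subst (λ S → Linked _≢_ (A + J ∷ S)) (sym (pathSums-altLabels A s δs offsets-below))
    (Linked-core-altSums δs steps-valid offsets-below pendant-valid)
    where
    Linked-core-altSums : ∀ δs → All (_∈ allowedSteps J) δs → All (_< A) (offsets s δs) → pendant s δs ∈ pendantColours A →
                Linked _≢_ (A + J ∷ altSums A s δs)
    Linked-core-altSums []       _     _   p∈ = A+J≢pendantColour 3≤J (subst (_∈ pendantColours A) (+-identityʳ s) p∈) ∷ [-]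
    Linked-core-altSums (δ ∷ δs) steps o<A _  =
      ≢-sym (<⇒≢ (m<m+n A (<-≤-trans z<s 3≤J)))
      ∷ Linked-altSums A s (δ ∷ δs) (All.map (step-positive (<-≤-trans z<s 3≤J)) steps) o<A

  altLabels-colours : All (_∈ colours A J) (pathSums (altLabels A s δs))
  altLabels-colours = subst (All (_∈ colours A J)) (sym (pathSums-altLabels A s δs offsets-below))
    (altSums-colours A J s δs steps-valid pendant-valid)

offsets⊆altLabels : ∀ A s δs → offsets s δs ⊆ altLabels A s δs
offsets⊆altLabels A s (δ ∷ δs) (here refl) = here refl
offsets⊆altLabels A s (δ ∷ δs) (there o∈)  = there (there (offsets⊆altLabels A (s + δ) δs o∈))

∸offsets⊆altLabels : ∀ A s δs {o} → o ∈ offsets s δs → A ∸ o ∈ altLabels A s δs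
∸offsets⊆altLabels A s (δ ∷ δs) (here refl) = there (here refl)
∸offsets⊆altLabels A s (δ ∷ δs) (there o∈)  = there (there (∸offsets⊆altLabels A (s + δ) δs o∈))

pendant∈altLabels : ∀ A s δs → pendant s δs ∈ altLabels A s δs
pendant∈altLabels A s []       = here (+-identityʳ s)
pendant∈altLabels A s (δ ∷ δs) =
  there (there (subst (_∈ altLabels A (s + δ) δs) (pendant-∷ s δ δs) (pendant∈altLabels A (s + δ) δs)))

length-altLabels : ∀ A s δs → length (altLabels A s δs) ≡ 2 * length δs + 1
length-altLabels A s []       = refl
length-altLabels A s (δ ∷ δs) =
  trans (cong (suc ∘ suc) (length-altLabels A (s + δ) δs)) (two-more (length δs))
  where
  two-more : ∀ k → suc (suc (2 * k + 1)) ≡ 2 * suc k + 1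
  two-more = solve-∀

offsets-++ : ∀ s δs εs → offsets s (δs ++ εs) ≡ offsets s δs ++ offsets (pendant s δs) εs
offsets-++ s []       εs = cong (λ s′ → offsets s′ εs) (sym (+-identityʳ s))
offsets-++ s (δ ∷ δs) εs = cong (s ∷_) (trans (offsets-++ (s + δ) δs εs)
  (cong (λ s′ → offsets (s + δ) δs ++ offsets s′ εs) (pendant-∷ s δ δs)))

sum-replicate : ∀ k c → sum (replicate k c) ≡ k * c
sum-replicate zero    c = refl
sum-replicate (suc k) c = cong (c +_) (sum-replicate k c)

∈-offsets-replicate : ∀ s c k i → i < k → s + i * c ∈ offsets s (replicate k c)
∈-offsets-replicate s c (suc k) zero    _         = here (+-identityʳ s)
∈-offsets-replicate s c (suc k) (suc i) (s≤s i<k) =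
  there (subst (_∈ offsets (s + c) (replicate k c)) (+-assoc s c (i * c))
    (∈-offsets-replicate (s + c) c k i i<k))

∈-offsets-++ˡ : ∀ s δs εs {o} → o ∈ offsets s δs → o ∈ offsets s (δs ++ εs)
∈-offsets-++ˡ s δs εs o∈ = subst (_ ∈_) (sym (offsets-++ s δs εs)) (∈-++⁺ˡ o∈)

∈-offsets-++ʳ : ∀ s δs εs {o} → o ∈ offsets (pendant s δs) εs → o ∈ offsets s (δs ++ εs)
∈-offsets-++ʳ s δs εs o∈ = subst (_ ∈_) (sym (offsets-++ s δs εs)) (∈-++⁺ʳ (offsets s δs) o∈)

∈-offsets-replicate≤ : ∀ s c k δ δs i → i ≤ k → s + i * c ∈ offsets s (replicate k c ++ δ ∷ δs)
∈-offsets-replicate≤ s c k δ δs i i≤k with m≤n⇒m<n∨m≡n i≤k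
... | inj₁ i<k  = ∈-offsets-++ˡ s (replicate k c) (δ ∷ δs) (∈-offsets-replicate s c k i i<k)
... | inj₂ refl = ∈-offsets-++ʳ s (replicate i c) (δ ∷ δs) (here (cong (s +_) (sym (sum-replicate i c))))

∈-offsets-replicate-++ʳ : ∀ s c k εs {o} → o ∈ offsets (s + k * c) εs → o ∈ offsets s (replicate k c ++ εs)
∈-offsets-replicate-++ʳ s c k εs {o} o∈ =
  ∈-offsets-++ʳ s (replicate k c) εs
    (subst (λ s′ → o ∈ offsets s′ εs) (cong (s +_) (sym (sum-replicate k c))) o∈)

lastStep-++ : ∀ δs ε εs → lastStep (δs ++ ε ∷ εs) ≡ lastStep (ε ∷ εs)
lastStep-++ []            ε εs = refl
lastStep-++ (δ ∷ [])      ε εs = refl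
lastStep-++ (δ ∷ δ′ ∷ δs) ε εs = lastStep-++ (δ′ ∷ δs) ε εs

lastStep∈ : ∀ δ δs → lastStep (δ ∷ δs) ∈ δ ∷ δs
lastStep∈ δ []       = here refl
lastStep∈ δ (δ′ ∷ δs) = there (lastStep∈ δ′ δs)

lastStep-replicate : ∀ k c → lastStep (replicate (suc k) c) ≡ c
lastStep-replicate zero    c = refl
lastStep-replicate (suc k) c = lastStep-replicate k c

-- Covering 1 … K by runs of offsets

Covered : ℕ → List ℕ → ℕ → Set
Covered A O p = ∃[ o ] o ∈ O × (o ≡ p ⊎ o + p ≡ A)

∈-pendantColours : ∀ A z → A ≤ z → z ≤ A + 2 → z ∈ pendantColours A
∈-pendantColours A z A≤z z≤A+2 with m≤n⇒∃[o]m+o≡n A≤z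
... | 0 , refl = here (+-identityʳ A)
... | 1 , refl = there (here refl)
... | 2 , refl = there (there (here refl))
... | suc (suc (suc k)) , refl =
  ⊥-elim (1+n≰n (+-cancelˡ-≤ A 3 2 (≤-trans (+-monoʳ-≤ A (s≤s (s≤s (s≤s z≤n)))) z≤A+2)))

Covered⇒labels : ∀ A (O ls : List ℕ) → (∀ {o} → o ∈ O → o ∈ ls × A ∸ o ∈ ls) →
                 ∀ {p} → Covered A O p → p ∈ ls × A ∸ p ∈ ls
Covered⇒labels A O ls O⊆ (o , o∈ , inj₁ refl)  = O⊆ o∈
Covered⇒labels A O ls O⊆ {p} (o , o∈ , inj₂ refl) =
  subst (_∈ ls) (m+n∸m≡n o p) (proj₂ (O⊆ o∈)) , subst (_∈ ls) (sym (m+n∸n≡m o p)) (proj₁ (O⊆ o∈))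

labels-cover : ∀ A K (O ls : List ℕ) → A ≡ suc (K + K) →
  (∀ {o} → o ∈ O → o ∈ ls × A ∸ o ∈ ls) → (∀ p → 1 ≤ p → p ≤ K → Covered A O p) →
  pendantColours A ⊆ ls → ∀ z → 1 ≤ z → z ≤ A + 2 → z ∈ ls
labels-cover A K O ls A≡ O⊆ covered pendants z 1≤z z≤A+2 with z ≤? K | A ≤? z
... | yes z≤K | _       = proj₁ (Covered⇒labels A O ls O⊆ (covered z 1≤z z≤K))
... | no _    | yes A≤z = pendants (∈-pendantColours A z A≤z z≤A+2)
... | no z≰K  | no A≰z  = subst (_∈ ls) (m∸[m∸n]≡n (<⇒≤ z<A))
  (proj₂ (Covered⇒labels A O ls O⊆ (covered (A ∸ z) (m<n⇒0<n∸m z<A) (m≤n+o⇒m∸n≤o A z A≤z+K))))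
  where
  z<A : z < A
  z<A = ≰⇒> A≰z
  A≤z+K : A ≤ z + K
  A≤z+K = subst (_≤ z + K) (sym A≡) (+-monoˡ-≤ K (≰⇒> z≰K))

parity : ∀ d → ∃[ i ] (d ≡ 2 * i ⊎ d ≡ suc (2 * i))
parity zero          = 0 , inj₁ refl
parity (suc zero)    = 0 , inj₂ refl
parity (suc (suc d)) with parity d
... | i , inj₁ refl = suc i , inj₁ (cong suc (sym (+-suc i (i + 0))))
... | i , inj₂ refl = suc i , inj₂ (cong (suc ∘ suc) (sym (+-suc i (i + 0))))

interval-cover : ∀ {P : ℕ → Set} a m → (∀ i j → suc (i + j) ≡ m → P (a + i)) →
                 ∀ p → a ≤ p → p < a + m → P p
interval-cover a m family p a≤p p<a+m with m≤n⇒∃[o]m+o≡n a≤p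
... | i , refl with m≤n⇒∃[o]m+o≡n p<a+m
...   | j , a+i+1+j≡a+m = family i j (+-cancelˡ-≡ a _ m (begin
  a + suc (i + j) ≡⟨ +-suc a (i + j) ⟩
  suc (a + (i + j)) ≡⟨ cong suc (+-assoc a i j) ⟨
  suc (a + i + j) ≡⟨ a+i+1+j≡a+m ⟩
  a + m ∎))
  where open ≡-Reasoning

parity-cover : ∀ {P : ℕ → Set} a m →
  (∀ i j → i + j ≡ m → P (a + 2 * i)) → (∀ i j → suc (i + j) ≡ m → P (suc (a + 2 * i))) →
  ∀ p → a ≤ p → p ≤ a + 2 * m → P p
parity-cover a m even odd p a≤p p≤a+2m with m≤n⇒∃[o]m+o≡n a≤p
... | d , refl with parity d
...   | i , inj₁ refl with m≤n⇒∃[o]m+o≡n (*-cancelˡ-≤ 2 (+-cancelˡ-≤ a _ _ p≤a+2m))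
...     | j , i+j≡m = even i j i+j≡m
parity-cover {P} a m even odd p a≤p p≤a+2m | d , refl | i , inj₂ refl
  with m≤n⇒∃[o]m+o≡n (*-cancelˡ-< 2 i m (+-cancelˡ-≤ a _ _ p≤a+2m))
...     | j , i+1+j≡m = subst P (sym (+-suc a (2 * i))) (odd i j i+1+j≡m)

-- Labellings with four colours from alternating legs

SpiderLabeling≤4 : ℕ → ℕ → ℕ → Set
SpiderLabeling≤4 a b c = ∃[ ls ] IsLocalAntimagic (spider a b c) ls × numColors (spider a b c) ls ≤ 4

SpiderLabeling≤4-cong : ∀ {a b c a′ b′ c′} → a ≡ a′ → b ≡ b′ → c ≡ c′ →
                        SpiderLabeling≤4 a b c → SpiderLabeling≤4 a′ b′ c′
SpiderLabeling≤4-cong refl refl refl labeling = labeling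

record Design : Set where
  field
    A J K          : ℕ
    sᵃ sᵇ sᶜ       : ℕ
    δᵃ δᵇ δᶜ       : List ℕ
    A≡2K+1         : A ≡ suc (K + K)
    3≤J            : 3 ≤ J
    core           : sᵃ + (sᵇ + sᶜ) ≡ A + J
    properᵃ        : ProperLeg A J sᵃ δᵃ
    properᵇ        : ProperLeg A J sᵇ δᵇ
    properᶜ        : ProperLeg A J sᶜ δᶜ
    step-count     : length δᵃ + (length δᵇ + length δᶜ) ≡ K
    covered        : ∀ p → 1 ≤ p → p ≤ K → Covered A (offsets sᵃ δᵃ ++ offsets sᵇ δᵇ ++ offsets sᶜ δᶜ) p
    pendants       : pendantColours A ⊆ pendant sᵃ δᵃ ∷ pendant sᵇ δᵇ ∷ pendant sᶜ δᶜ ∷ []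

module _ (D : Design) where
  open Design D
  private
    La = altLabels A sᵃ δᵃ
    Lb = altLabels A sᵇ δᵇ
    Lc = altLabels A sᶜ δᶜ
    ls = La ++ Lb ++ Lc
    G = spiderOf La Lb Lc

    ∈ᵃ : La ⊆ ls
    ∈ᵃ = ⊆-++₃ˡ Lb
    ∈ᵇ : Lb ⊆ ls
    ∈ᵇ = ⊆-++₃ᵐ La
    ∈ᶜ : Lc ⊆ ls
    ∈ᶜ = ⊆-++₃ʳ La Lb

    coreSum≡ : coreSum La Lb Lc ≡ A + J
    coreSum≡ = trans (cong₂ _+_ (head₀-altLabels A sᵃ δᵃ)
                       (cong₂ _+_ (head₀-altLabels A sᵇ δᵇ) (head₀-altLabels A sᶜ δᶜ))) core

    q≡A+2 : q G ≡ A + 2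
    q≡A+2 = begin
      q G                                          ≡⟨ q-spider (length La) (length Lb) (length Lc) ⟩
      length La + (length Lb + length Lc)          ≡⟨ cong₂ _+_ (length-altLabels A sᵃ δᵃ)
                                                       (cong₂ _+_ (length-altLabels A sᵇ δᵇ) (length-altLabels A sᶜ δᶜ)) ⟩
      (2 * ka + 1) + ((2 * kb + 1) + (2 * kc + 1)) ≡⟨ three-legs ka kb kc ⟩
      suc (2 * (ka + (kb + kc))) + 2               ≡⟨ cong (λ k → suc (2 * k) + 2) step-count ⟩
      suc (2 * K) + 2                              ≡⟨ cong (λ k → suc (K + k) + 2) (+-identityʳ K) ⟩
      suc (K + K) + 2                              ≡⟨ cong (_+ 2) A≡2K+1 ⟨
      A + 2                                        ∎
      where
      open ≡-Reasoning
      ka = length δᵃ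
      kb = length δᵇ
      kc = length δᶜ
      three-legs : ∀ a b c → (2 * a + 1) + ((2 * b + 1) + (2 * c + 1)) ≡ suc (2 * (a + (b + c))) + 2
      three-legs = solve-∀

    offsets⊆labels : ∀ {o} → o ∈ offsets sᵃ δᵃ ++ offsets sᵇ δᵇ ++ offsets sᶜ δᶜ → o ∈ ls × A ∸ o ∈ ls
    offsets⊆labels o∈ with ∈-++⁻ (offsets sᵃ δᵃ) o∈
    ... | inj₁ o∈ᵃ = ∈ᵃ (offsets⊆altLabels A sᵃ δᵃ o∈ᵃ) , ∈ᵃ (∸offsets⊆altLabels A sᵃ δᵃ o∈ᵃ)
    ... | inj₂ o∈ᵇᶜ with ∈-++⁻ (offsets sᵇ δᵇ) o∈ᵇᶜ
    ...   | inj₁ o∈ᵇ = ∈ᵇ (offsets⊆altLabels A sᵇ δᵇ o∈ᵇ) , ∈ᵇ (∸offsets⊆altLabels A sᵇ δᵇ o∈ᵇ)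
    ...   | inj₂ o∈ᶜ = ∈ᶜ (offsets⊆altLabels A sᶜ δᶜ o∈ᶜ) , ∈ᶜ (∸offsets⊆altLabels A sᶜ δᶜ o∈ᶜ)

    pendants⊆labels : pendantColours A ⊆ ls
    pendants⊆labels z∈ with pendants z∈
    ... | here refl                 = ∈ᵃ (pendant∈altLabels A sᵃ δᵃ)
    ... | there (here refl)         = ∈ᵇ (pendant∈altLabels A sᵇ δᵇ)
    ... | there (there (here refl)) = ∈ᶜ (pendant∈altLabels A sᶜ δᶜ)

    bijective : IsBijectiveLabeling G ls
    bijective = Unique-⊆⇒↭ (map suc (upTo (q G))) ls (Unique-upTo+1 (q G))
      (λ {z} z∈ → let 1≤z , z≤q = ∈-labels⁻ (q G) z∈ in
        labels-cover A K _ ls A≡2K+1 offsets⊆labels covered pendants⊆labels z 1≤z (subst (z ≤_) q≡A+2 z≤q))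
      (≤-reflexive (begin
        length ls                              ≡⟨ length-++ La ⟩
        length La + length (Lb ++ Lc)          ≡⟨ cong (length La +_) (length-++ Lb) ⟩
        length La + (length Lb + length Lc)    ≡⟨ q-spider (length La) (length Lb) (length Lc) ⟨
        q G                                    ≡⟨ length-upTo (q G) ⟨
        length (upTo (q G))                    ≡⟨ length-map suc (upTo (q G)) ⟨
        length (map suc (upTo (q G)))          ∎))
      where open ≡-Reasoning

    adjacent-distinct : ∀ u v → (u , v) ∈ edges G → vsum G ls u ≢ vsum G ls v
    adjacent-distinct = vsum-spider-adjacent La Lb Lc (proper properᵃ) (proper properᵇ) (proper properᶜ)
      where
      proper : ∀ {s δs} → ProperLeg A J s δs → Linked _≢_ (coreSum La Lb Lc ∷ pathSums (altLabels A s δs))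
      proper {s} {δs} p =
        subst (λ X → Linked _≢_ (X ∷ pathSums (altLabels A s δs))) (sym coreSum≡) (Linked-core-altLabels 3≤J p)

    sums-coloured : All (_∈ colours A J) (spiderSums La Lb Lc)
    sums-coloured = subst (_∈ colours A J) (sym coreSum≡) (∈-++⁺ʳ (pendantColours A) (here refl))
      ∷ All-++⁺ (altLabels-colours 3≤J properᵃ)
          (All-++⁺ (altLabels-colours 3≤J properᵇ) (altLabels-colours 3≤J properᶜ))

    at-most-4 : numColors G ls ≤ 4
    at-most-4 = subst (λ S → length (deduplicate _≟_ S) ≤ 4) (sym (vsums-spider La Lb Lc))
      (Unique-⊆⇒length≤ (deduplicate _≟_ (spiderSums La Lb Lc)) (colours A J) (deduplicate-! (spiderSums La Lb Lc))
        (All.lookup sums-coloured ∘ ∈-deduplicate⁻ _≟_ (spiderSums La Lb Lc)))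

  design-labeling : ∀ {ka kb kc} → length δᵃ ≡ ka → length δᵇ ≡ kb → length δᶜ ≡ kc →
                    SpiderLabeling≤4 (2 * ka + 1) (2 * kb + 1) (2 * kc + 1)
  design-labeling refl refl refl =
    SpiderLabeling≤4-cong (length-altLabels A sᵃ δᵃ) (length-altLabels A sᵇ δᵇ) (length-altLabels A sᶜ δᶜ)
      (ls , (bijective , adjacent-distinct) , at-most-4)

rotate : Design → Design
rotate D = record
  { A = A ; J = J ; K = K
  ; sᵃ = sᵇ ; sᵇ = sᶜ ; sᶜ = sᵃ
  ; δᵃ = δᵇ ; δᵇ = δᶜ ; δᶜ = δᵃ
  ; A≡2K+1 = A≡2K+1
  ; 3≤J = 3≤J
  ; core = trans (sym (+-rotate sᵃ sᵇ sᶜ)) core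
  ; properᵃ = properᵇ ; properᵇ = properᶜ ; properᶜ = properᵃ
  ; step-count = trans (sym (+-rotate (length δᵃ) (length δᵇ) (length δᶜ))) step-count
  ; covered = λ p 1≤p p≤K → let o , o∈ , reflected = covered p 1≤p p≤K in
      o , ++-rotate (offsets sᵃ δᵃ) (offsets sᵇ δᵇ) _ o∈ , reflected
  ; pendants = λ z∈ → ∷-rotate (pendants z∈)
  }
  where
  open Design D
  +-rotate : ∀ x y z → x + (y + z) ≡ y + (z + x)
  +-rotate x y z = trans (+-comm x (y + z)) (+-assoc y z x)
  ++-rotate : ∀ {o} (xs ys zs : List ℕ) → o ∈ xs ++ ys ++ zs → o ∈ ys ++ zs ++ xs
  ++-rotate {o} xs ys zs o∈ = subst (o ∈_) (++-assoc ys zs xs) (∈-resp-↭ (++-comm xs (ys ++ zs)) o∈)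
  ∷-rotate : ∀ {o x y z : ℕ} → o ∈ x ∷ y ∷ z ∷ [] → o ∈ y ∷ z ∷ x ∷ []
  ∷-rotate (here o≡x)                 = there (there (here o≡x))
  ∷-rotate (there (here o≡y))         = here o≡y
  ∷-rotate (there (there (here o≡z))) = there (here o≡z)

-- The offsets cover 1 … K in four runs: 1 … 2t+1 alternately reflected from the final blocks of legs c
-- and b, then 2t+2 … 2t+r₂+1 reflected from the first block of leg c, then 2t+r₂+2 … K−t−1 directly
-- from the first block of leg b, and finally K−t … K, zig-zagging through leg a.
module LongLegs where
  K A J sᵃ sᵇ sᶜ : ℕ → ℕ → ℕ → ℕ
  K t r₁ r₂ = 3 * t + r₁ + r₂ + 3
  A t r₁ r₂ = 6 * t + 2 * r₁ + 2 * r₂ + 7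
  J t r₁ r₂ = 2 * t + r₁ + r₂ + 5
  sᵃ t r₁ r₂ = 2 * t + r₁ + r₂ + 4
  sᵇ t r₁ r₂ = 2 * t + r₂ + 2
  sᶜ t r₁ r₂ = 4 * t + 2 * r₁ + r₂ + 6

  δᵃ δᵇ δᶜ : ℕ → ℕ → ℕ → List ℕ
  δᵃ t r₁ r₂ = replicate t 2 ++ J t r₁ r₂ ∷ []
  δᵇ t r₁ r₂ = replicate r₁ 1 ++ J t r₁ r₂ ∷ replicate t 2
  δᶜ t r₁ r₂ = replicate r₂ 1 ++ replicate (suc t) 2

  module _ (t r₁ r₂ : ℕ) where
    Oᵃ Oᵇ Oᶜ O : List ℕ
    Oᵃ = offsets (sᵃ t r₁ r₂) (δᵃ t r₁ r₂)
    Oᵇ = offsets (sᵇ t r₁ r₂) (δᵇ t r₁ r₂)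
    Oᶜ = offsets (sᶜ t r₁ r₂) (δᶜ t r₁ r₂)
    O = Oᵃ ++ Oᵇ ++ Oᶜ

  run₁-odd : ∀ t r₁ r₂ i j → i + j ≡ t → Covered (A t r₁ r₂) (O t r₁ r₂) (1 + 2 * i)
  run₁-odd .(i + j) r₁ r₂ i j refl =
    _ , ⊆-++₃ʳ (Oᵃ t r₁ r₂) (Oᵇ t r₁ r₂)
          (∈-offsets-replicate-++ʳ _ 1 r₂ _ (∈-offsets-replicate _ 2 (suc t) j (s≤s (m≤n+m j i)))) ,
    inj₂ (identity r₁ r₂ i j)
    where
    t = i + j
    identity : ∀ r₁ r₂ i j → 4 * (i + j) + 2 * r₁ + r₂ + 6 + r₂ * 1 + j * 2 + (1 + 2 * i)
                             ≡ 6 * (i + j) + 2 * r₁ + 2 * r₂ + 7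
    identity = solve-∀

  run₁-even : ∀ t r₁ r₂ i j → suc (i + j) ≡ t → Covered (A t r₁ r₂) (O t r₁ r₂) (suc (1 + 2 * i))
  run₁-even .(suc (i + j)) r₁ r₂ i j refl =
    _ , ⊆-++₃ᵐ (Oᵃ t r₁ r₂)
          (∈-offsets-replicate-++ʳ _ 1 r₁ _ (there (∈-offsets-replicate _ 2 t j (s≤s (m≤n+m j i))))) ,
    inj₂ (identity r₁ r₂ i j)
    where
    t = suc (i + j)
    identity : ∀ r₁ r₂ i j → 2 * suc (i + j) + r₂ + 2 + r₁ * 1 + (2 * suc (i + j) + r₁ + r₂ + 5) + j * 2
                             + suc (1 + 2 * i) ≡ 6 * suc (i + j) + 2 * r₁ + 2 * r₂ + 7
    identity = solve-∀

  run₂ : ∀ t r₁ r₂ i j → suc (i + j) ≡ r₂ → Covered (A t r₁ r₂) (O t r₁ r₂) (suc (2 * t + 1) + i)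
  run₂ t r₁ .(suc (i + j)) i j refl =
    _ , ⊆-++₃ʳ (Oᵃ t r₁ r₂) (Oᵇ t r₁ r₂)
          (∈-offsets-++ˡ _ (replicate r₂ 1) _ (∈-offsets-replicate _ 1 r₂ j (s≤s (m≤n+m j i)))) ,
    inj₂ (identity t r₁ i j)
    where
    r₂ = suc (i + j)
    identity : ∀ t r₁ i j → 4 * t + 2 * r₁ + suc (i + j) + 6 + j * 1 + (suc (2 * t + 1) + i)
                            ≡ 6 * t + 2 * r₁ + 2 * suc (i + j) + 7
    identity = solve-∀

  run₃ : ∀ t r₁ r₂ i j → suc (i + j) ≡ suc r₁ → Covered (A t r₁ r₂) (O t r₁ r₂) (suc (2 * t + 1) + r₂ + i)
  run₃ t .(i + j) r₂ i j refl =
    _ , ⊆-++₃ᵐ (Oᵃ t (i + j) r₂) (∈-offsets-replicate≤ _ 1 (i + j) _ _ i (m≤m+n i j)) , inj₁ (identity t r₂ i)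
    where
    identity : ∀ t r₂ i → 2 * t + r₂ + 2 + i * 1 ≡ suc (2 * t + 1) + r₂ + i
    identity = solve-∀

  run₄-even : ∀ t r₁ r₂ i j → i + j ≡ t →
              Covered (A t r₁ r₂) (O t r₁ r₂) (suc (2 * t + 1) + r₂ + suc r₁ + 2 * i)
  run₄-even .(i + j) r₁ r₂ i j refl =
    _ , ⊆-++₃ˡ (Oᵇ (i + j) r₁ r₂) (∈-offsets-replicate≤ _ 2 (i + j) _ [] j (m≤n+m j i)) ,
    inj₂ (identity r₁ r₂ i j)
    where
    identity : ∀ r₁ r₂ i j → 2 * (i + j) + r₁ + r₂ + 4 + j * 2 + (suc (2 * (i + j) + 1) + r₂ + suc r₁ + 2 * i)
                             ≡ 6 * (i + j) + 2 * r₁ + 2 * r₂ + 7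
    identity = solve-∀

  run₄-odd : ∀ t r₁ r₂ i j → suc (i + j) ≡ t →
             Covered (A t r₁ r₂) (O t r₁ r₂) (suc (suc (2 * t + 1) + r₂ + suc r₁ + 2 * i))
  run₄-odd .(suc (i + j)) r₁ r₂ i j refl =
    _ , ⊆-++₃ˡ (Oᵇ t r₁ r₂) (∈-offsets-++ˡ _ (replicate t 2) _ (∈-offsets-replicate _ 2 t i (s≤s (m≤m+n i j)))) ,
    inj₁ (identity r₁ r₂ i j)
    where
    t = suc (i + j)
    identity : ∀ r₁ r₂ i j → 2 * suc (i + j) + r₁ + r₂ + 4 + i * 2
                             ≡ suc (suc (2 * suc (i + j) + 1) + r₂ + suc r₁ + 2 * i)
    identity = solve-∀

  covered : ∀ t r₁ r₂ p → 1 ≤ p → p ≤ K t r₁ r₂ → Covered (A t r₁ r₂) (O t r₁ r₂) p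
  covered t r₁ r₂ p 1≤p p≤K with p ≤? 2 * t + 1
  ... | yes p≤ = parity-cover {P = Covered (A t r₁ r₂) (O t r₁ r₂)} 1 t (run₁-odd t r₁ r₂) (run₁-even t r₁ r₂)
                   p 1≤p (subst (p ≤_) (+-comm (2 * t) 1) p≤)
  ... | no p≰ with p <? suc (2 * t + 1) + r₂
  ...   | yes p< = interval-cover {P = Covered (A t r₁ r₂) (O t r₁ r₂)} (suc (2 * t + 1)) r₂ (run₂ t r₁ r₂)
                     p (≰⇒> p≰) p<
  ...   | no p≮ with p <? suc (2 * t + 1) + r₂ + suc r₁
  ...     | yes p< = interval-cover {P = Covered (A t r₁ r₂) (O t r₁ r₂)} (suc (2 * t + 1) + r₂) (suc r₁)
                       (run₃ t r₁ r₂) p (≮⇒≥ p≮) p<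
  ...     | no p≮′ = parity-cover {P = Covered (A t r₁ r₂) (O t r₁ r₂)} (suc (2 * t + 1) + r₂ + suc r₁) t
                       (run₄-even t r₁ r₂) (run₄-odd t r₁ r₂) p (≮⇒≥ p≮′)
                       (≤-trans p≤K (≤-trans (≤-reflexive (K≡ t r₁ r₂)) (+-monoʳ-≤ _ (m≤m+n t (t + 0)))))
    where
    K≡ : ∀ t r₁ r₂ → 3 * t + r₁ + r₂ + 3 ≡ suc (2 * t + 1) + r₂ + suc r₁ + t
    K≡ = solve-∀

  module _ (t r₁ r₂ : ℕ) where
    private
      A′ = A t r₁ r₂
      J′ = J t r₁ r₂

    3≤J : 3 ≤ J′
    3≤J = ≤-trans (s≤s (s≤s (s≤s z≤n))) (m≤n+m 5 (2 * t + r₁ + r₂))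

    pendantᵃ : pendant (sᵃ t r₁ r₂) (δᵃ t r₁ r₂) ≡ A′ + 2
    pendantᵃ = trans
      (cong (sᵃ t r₁ r₂ +_) (trans (sum-++ (replicate t 2) (J′ ∷ [])) (cong (_+ (J′ + 0)) (sum-replicate t 2))))
      (identity t r₁ r₂)
      where
      identity : ∀ t r₁ r₂ → 2 * t + r₁ + r₂ + 4 + (t * 2 + ((2 * t + r₁ + r₂ + 5) + 0))
                             ≡ 6 * t + 2 * r₁ + 2 * r₂ + 7 + 2
      identity = solve-∀

    pendantᵇ : pendant (sᵇ t r₁ r₂) (δᵇ t r₁ r₂) ≡ A′
    pendantᵇ = trans
      (cong (sᵇ t r₁ r₂ +_) (trans (sum-++ (replicate r₁ 1) _)
        (cong₂ _+_ (sum-replicate r₁ 1) (cong (J′ +_) (sum-replicate t 2)))))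
      (identity t r₁ r₂)
      where
      identity : ∀ t r₁ r₂ → 2 * t + r₂ + 2 + (r₁ * 1 + ((2 * t + r₁ + r₂ + 5) + t * 2))
                             ≡ 6 * t + 2 * r₁ + 2 * r₂ + 7
      identity = solve-∀

    pendantᶜ : pendant (sᶜ t r₁ r₂) (δᶜ t r₁ r₂) ≡ A′ + 1
    pendantᶜ = trans
      (cong (sᶜ t r₁ r₂ +_) (trans (sum-++ (replicate r₂ 1) _)
        (cong₂ _+_ (sum-replicate r₂ 1) (sum-replicate (suc t) 2))))
      (identity t r₁ r₂)
      where
      identity : ∀ t r₁ r₂ → 4 * t + 2 * r₁ + r₂ + 6 + (r₂ * 1 + suc t * 2) ≡ 6 * t + 2 * r₁ + 2 * r₂ + 7 + 1
      identity = solve-∀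

    properᵃ : ProperLeg A′ J′ (sᵃ t r₁ r₂) (δᵃ t r₁ r₂)
    properᵃ = record
      { steps-valid   = All-++⁺ (All-replicate⁺ t (there (here refl))) (there (there (here refl)) ∷ [])
      ; offsets-below = pendant<⇒offsets< A′ _ (δᵃ t r₁ r₂)
          (subst₂ _<_ (sym pendantᵃ) (cong (A′ +_) (sym (lastStep-++ (replicate t 2) J′ []))) (+-monoʳ-< A′ 3≤J))
      ; pendant-valid = there (there (here pendantᵃ))
      }

    properᵇ : ProperLeg A′ J′ (sᵇ t r₁ r₂) (δᵇ t r₁ r₂)
    properᵇ = record
      { steps-valid   = All-++⁺ (All-replicate⁺ r₁ (here refl)) last-steps
      ; offsets-below = pendant<⇒offsets< A′ _ (δᵇ t r₁ r₂)
          (subst₂ _<_ (sym pendantᵇ) (cong (A′ +_) (sym (lastStep-++ (replicate r₁ 1) J′ (replicate t 2))))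
            (m<m+n A′ (step-positive (≤-trans z<s 3≤J) (All.lookup last-steps (lastStep∈ J′ (replicate t 2))))))
      ; pendant-valid = here pendantᵇ
      }
      where
      last-steps : All (_∈ allowedSteps J′) (J′ ∷ replicate t 2)
      last-steps = there (there (here refl)) ∷ All-replicate⁺ t (there (here refl))

    properᶜ : ProperLeg A′ J′ (sᶜ t r₁ r₂) (δᶜ t r₁ r₂)
    properᶜ = record
      { steps-valid   = All-++⁺ (All-replicate⁺ r₂ (here refl)) (All-replicate⁺ (suc t) (there (here refl)))
      ; offsets-below = pendant<⇒offsets< A′ _ (δᶜ t r₁ r₂)
          (subst₂ _<_ (sym pendantᶜ)
            (cong (A′ +_) (sym (trans (lastStep-++ (replicate r₂ 1) 2 (replicate t 2)) (lastStep-replicate t 2))))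
            (+-monoʳ-< A′ ≤-refl))
      ; pendant-valid = there (here pendantᶜ)
      }

    length-δᵃ : length (δᵃ t r₁ r₂) ≡ t + 1
    length-δᵃ = trans (length-++ (replicate t 2)) (cong (_+ 1) (length-replicate t))

    length-δᵇ : length (δᵇ t r₁ r₂) ≡ r₁ + suc t
    length-δᵇ = trans (length-++ (replicate r₁ 1)) (cong₂ _+_ (length-replicate r₁) (cong suc (length-replicate t)))

    length-δᶜ : length (δᶜ t r₁ r₂) ≡ r₂ + suc t
    length-δᶜ = trans (length-++ (replicate r₂ 1)) (cong₂ _+_ (length-replicate r₂) (length-replicate (suc t)))

    design : Design
    design = record
      { A = A′ ; J = J′ ; K = K t r₁ r₂
      ; sᵃ = sᵃ t r₁ r₂ ; sᵇ = sᵇ t r₁ r₂ ; sᶜ = sᶜ t r₁ r₂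
      ; δᵃ = δᵃ t r₁ r₂ ; δᵇ = δᵇ t r₁ r₂ ; δᶜ = δᶜ t r₁ r₂
      ; A≡2K+1 = A≡2K+1 t r₁ r₂
      ; 3≤J = 3≤J
      ; core = core t r₁ r₂
      ; properᵃ = properᵃ ; properᵇ = properᵇ ; properᶜ = properᶜ
      ; step-count = trans (cong₂ _+_ length-δᵃ (cong₂ _+_ length-δᵇ length-δᶜ)) (count t r₁ r₂)
      ; covered = covered t r₁ r₂
      ; pendants = λ { (here refl)                 → there (here (sym pendantᵇ))
                     ; (there (here refl))         → there (there (here (sym pendantᶜ)))
                     ; (there (there (here refl))) → here (sym pendantᵃ) }
      }
      where
      A≡2K+1 : ∀ t r₁ r₂ → 6 * t + 2 * r₁ + 2 * r₂ + 7 ≡ suc ((3 * t + r₁ + r₂ + 3) + (3 * t + r₁ + r₂ + 3))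
      A≡2K+1 = solve-∀
      core : ∀ t r₁ r₂ → 2 * t + r₁ + r₂ + 4 + (2 * t + r₂ + 2 + (4 * t + 2 * r₁ + r₂ + 6))
                         ≡ 6 * t + 2 * r₁ + 2 * r₂ + 7 + (2 * t + r₁ + r₂ + 5)
      core = solve-∀
      count : ∀ t r₁ r₂ → t + 1 + (r₁ + suc t + (r₂ + suc t)) ≡ 3 * t + r₁ + r₂ + 3
      count = solve-∀

-- Leg a is the single edge A+2. The offsets cover 1 … 2e+1 alternately reflected from legs c and b; then
-- 2e+2 is reflected from leg b, while 2e+3, 2e+5, … are reflected from and 2e+4, 2e+6, … taken directly
-- from leg c.
module ShortLeg where
  K A J sᵃ sᵇ sᶜ : ℕ → ℕ
  K e = 3 * e + 2
  A e = 6 * e + 5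
  J e = 6 * e + 9
  sᵃ e = 6 * e + 7
  sᵇ e = 4 * e + 3
  sᶜ e = 2 * e + 4

  δᵇ δᶜ : ℕ → List ℕ
  δᵇ e = replicate (suc e) 2
  δᶜ e = replicate (suc (2 * e)) 2

  O : ℕ → List ℕ
  O e = offsets (sᵃ e) [] ++ offsets (sᵇ e) (δᵇ e) ++ offsets (sᶜ e) (δᶜ e)

  private
    ≤-double : ∀ {x y} → x ≤ y → x ≤ 2 * y
    ≤-double {y = y} x≤y = ≤-trans x≤y (m≤m+n y (y + 0))

  run₁-odd : ∀ e i j → i + j ≡ e → Covered (A e) (O e) (1 + 2 * i)
  run₁-odd .(i + j) i j refl =
    _ , ⊆-++₃ʳ [] (offsets (sᵇ e) (δᵇ e))
          (∈-offsets-replicate _ 2 _ (e + j) (s≤s (+-monoʳ-≤ e (≤-trans (m≤n+m j i) (m≤m+n e 0))))) ,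
    inj₂ (identity i j)
    where
    e = i + j
    identity : ∀ i j → 2 * (i + j) + 4 + (i + j + j) * 2 + (1 + 2 * i) ≡ 6 * (i + j) + 5
    identity = solve-∀

  run₁-even : ∀ e i j → suc (i + j) ≡ e → Covered (A e) (O e) (suc (1 + 2 * i))
  run₁-even .(suc (i + j)) i j refl =
    _ , ⊆-++₃ᵐ [] (∈-offsets-replicate _ 2 _ (suc j) (s≤s (s≤s (m≤n+m j i)))) , inj₂ (identity i j)
    where
    identity : ∀ i j → 4 * suc (i + j) + 3 + suc j * 2 + suc (1 + 2 * i) ≡ 6 * suc (i + j) + 5
    identity = solve-∀

  run₂-even : ∀ e i j → i + j ≡ e → Covered (A e) (O e) (suc (1 + 2 * e) + 2 * i)
  run₂-even .(0 + j) zero j refl = _ , ⊆-++₃ᵐ [] {offsets (sᵇ j) (δᵇ j)} (here refl) , inj₂ (identity j)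
    where
    identity : ∀ j → 4 * j + 3 + (suc (1 + 2 * j) + 2 * 0) ≡ 6 * j + 5
    identity = solve-∀
  run₂-even .(suc i + j) (suc i) j refl =
    _ , ⊆-++₃ʳ [] (offsets (sᵇ e) (δᵇ e))
          (∈-offsets-replicate _ 2 _ i (s≤s (≤-double (≤-trans (n≤1+n i) (m≤m+n (suc i) j))))) ,
    inj₁ (identity i j)
    where
    e = suc i + j
    identity : ∀ i j → 2 * (suc i + j) + 4 + i * 2 ≡ suc (1 + 2 * (suc i + j)) + 2 * suc i
    identity = solve-∀

  run₂-odd : ∀ e i j → suc (i + j) ≡ e → Covered (A e) (O e) (suc (suc (1 + 2 * e) + 2 * i))
  run₂-odd .(suc (i + j)) i j refl =
    _ , ⊆-++₃ʳ [] (offsets (sᵇ e) (δᵇ e))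
          (∈-offsets-replicate _ 2 _ j (s≤s (≤-double (≤-trans (m≤n+m j i) (n≤1+n (i + j)))))) ,
    inj₂ (identity i j)
    where
    e = suc (i + j)
    identity : ∀ i j → 2 * suc (i + j) + 4 + j * 2 + suc (suc (1 + 2 * suc (i + j)) + 2 * i)
                       ≡ 6 * suc (i + j) + 5
    identity = solve-∀

  covered : ∀ e p → 1 ≤ p → p ≤ K e → Covered (A e) (O e) p
  covered e p 1≤p p≤K with p ≤? 1 + 2 * e
  ... | yes p≤ = parity-cover {P = Covered (A e) (O e)} 1 e (run₁-odd e) (run₁-even e) p 1≤p p≤
  ... | no p≰  = parity-cover {P = Covered (A e) (O e)} (suc (1 + 2 * e)) e (run₂-even e) (run₂-odd e) p (≰⇒> p≰)
                   (≤-trans p≤K (K≤ e))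
    where
    K≤ : ∀ e → 3 * e + 2 ≤ suc (1 + 2 * e) + 2 * e
    K≤ e = subst (_≤ suc (1 + 2 * e) + 2 * e) (sym (K≡ e)) (+-monoʳ-≤ (suc (1 + 2 * e)) (m≤m+n e (e + 0)))
      where
      K≡ : ∀ e → 3 * e + 2 ≡ suc (1 + 2 * e) + e
      K≡ = solve-∀

  module _ (e : ℕ) where
    pendantᵇ : pendant (sᵇ e) (δᵇ e) ≡ A e
    pendantᵇ = trans (cong (sᵇ e +_) (sum-replicate (suc e) 2)) (identity e)
      where
      identity : ∀ e → 4 * e + 3 + suc e * 2 ≡ 6 * e + 5
      identity = solve-∀

    pendantᶜ : pendant (sᶜ e) (δᶜ e) ≡ A e + 1
    pendantᶜ = trans (cong (sᶜ e +_) (sum-replicate (suc (2 * e)) 2)) (identity e)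
      where
      identity : ∀ e → 2 * e + 4 + suc (2 * e) * 2 ≡ 6 * e + 5 + 1
      identity = solve-∀

    pendantᵃ : pendant (sᵃ e) [] ≡ A e + 2
    pendantᵃ = identity e
      where
      identity : ∀ e → 6 * e + 7 + 0 ≡ 6 * e + 5 + 2
      identity = solve-∀

    steps-of-2 : ∀ k → All (_∈ allowedSteps (J e)) (replicate k 2)
    steps-of-2 k = All-replicate⁺ k (there (here refl))

    offsets-below-A : ∀ s k → pendant s (replicate (suc k) 2) < A e + 2 →
                      All (_< A e) (offsets s (replicate (suc k) 2))
    offsets-below-A s k p< = pendant<⇒offsets< (A e) s _
      (subst (λ d → pendant s (replicate (suc k) 2) < A e + d) (sym (lastStep-replicate k 2)) p<)

    design : Design
    design = record
      { A = A e ; J = J e ; K = K e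
      ; sᵃ = sᵃ e ; sᵇ = sᵇ e ; sᶜ = sᶜ e
      ; δᵃ = [] ; δᵇ = δᵇ e ; δᶜ = δᶜ e
      ; A≡2K+1 = A≡2K+1 e
      ; 3≤J = ≤-trans (s≤s (s≤s (s≤s z≤n))) (m≤n+m 9 (6 * e))
      ; core = core e
      ; properᵃ = record
          { steps-valid = [] ; offsets-below = [] ; pendant-valid = there (there (here pendantᵃ)) }
      ; properᵇ = record
          { steps-valid = steps-of-2 (suc e)
          ; offsets-below = offsets-below-A (sᵇ e) e (subst (_< A e + 2) (sym pendantᵇ) (m<m+n (A e) z<s))
          ; pendant-valid = here pendantᵇ
          }
      ; properᶜ = record
          { steps-valid = steps-of-2 (suc (2 * e))
          ; offsets-below =
              offsets-below-A (sᶜ e) (2 * e) (subst (_< A e + 2) (sym pendantᶜ) (+-monoʳ-< (A e) ≤-refl))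
          ; pendant-valid = there (here pendantᶜ)
          }
      ; step-count = trans (cong₂ _+_ (length-replicate (suc e)) (length-replicate (suc (2 * e)))) (count e)
      ; covered = covered e
      ; pendants = λ { (here refl)                 → there (here (sym pendantᵇ))
                     ; (there (here refl))         → there (there (here (sym pendantᶜ)))
                     ; (there (there (here refl))) → here (sym pendantᵃ) }
      }
      where
      A≡2K+1 : ∀ e → 6 * e + 5 ≡ suc ((3 * e + 2) + (3 * e + 2))
      A≡2K+1 = solve-∀
      core : ∀ e → 6 * e + 7 + (4 * e + 3 + (2 * e + 4)) ≡ 6 * e + 5 + (6 * e + 9)
      core = solve-∀
      count : ∀ e → suc e + suc (2 * e) ≡ 3 * e + 2
      count = solve-∀

chiLa-spider : ∀ a b c → 0 < a → 0 < b → 0 < c → SpiderLabeling≤4 a b c → ChiLa (spider a b c) 4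
chiLa-spider a b c 0<a 0<b 0<c (ls , antimagic , ≤4) =
  (ls , antimagic , ≤-antisym ≤4 (at-least-4 ls antimagic)) , at-least-4
  where
  at-least-4 = numColors-spider≥4 a b c 0<a 0<b 0<c

spider-labeling : ∀ n d → SpiderLabeling≤4 (2 * n + 1) (2 * (suc n + d) + 1) (2 * (2 * d + 1) + 1)
spider-labeling zero d =
  design-labeling (ShortLeg.design d) refl (length-replicate (suc d))
    (trans (length-replicate (suc (2 * d))) (+-comm 1 (2 * d)))
spider-labeling (suc t) d with ≤-total t (2 * d)
... | inj₁ t≤2d with m≤n⇒∃[o]m+o≡n t≤2d
...   | r₂ , t+r₂≡2d = design-labeling (LongLegs.design t (suc d) r₂)
  (trans (LongLegs.length-δᵃ t (suc d) r₂) (+-comm t 1))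
  (trans (LongLegs.length-δᵇ t (suc d) r₂) (swap-legs t d))
  (trans (LongLegs.length-δᶜ t (suc d) r₂)
    (trans (+-suc r₂ t) (trans (cong suc (trans (+-comm r₂ t) t+r₂≡2d)) (+-comm 1 (2 * d)))))
  where
  swap-legs : ∀ t d → suc d + suc t ≡ suc (suc t) + d
  swap-legs = solve-∀
spider-labeling (suc t) d | inj₂ 2d≤t with m≤n⇒∃[o]m+o≡n 2d≤t
...   | u , refl = design-labeling (rotate (LongLegs.design (2 * d) u (suc (d + u))))
  (trans (LongLegs.length-δᵇ (2 * d) u (suc (d + u))) (trans (+-suc u (2 * d)) (cong suc (+-comm u (2 * d)))))
  (trans (LongLegs.length-δᶜ (2 * d) u (suc (d + u))) (swap-legs d u))
  (LongLegs.length-δᵃ (2 * d) u (suc (d + u)))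
  where
  swap-legs : ∀ d u → suc (d + u) + suc (2 * d) ≡ suc (suc (2 * d + u)) + d
  swap-legs = solve-∀

theorem5p5 : (m n : ℕ) → n < m →
    ChiLa (spider (2 * n + 1) (2 * m + 1) (4 * (m ∸ n) ∸ 1)) 4
theorem5p5 m n n<m with m≤n⇒∃[o]m+o≡n n<m
... | d , refl = subst (λ c → ChiLa (spider (2 * n + 1) (2 * (suc n + d) + 1) c) 4) (sym third-leg)
  (chiLa-spider _ _ _ (m≤n+m 1 (2 * n)) (m≤n+m 1 (2 * (suc n + d))) (m≤n+m 1 (2 * (2 * d + 1)))
    (spider-labeling n d))
  where
  third-leg : 4 * (suc n + d ∸ n) ∸ 1 ≡ 2 * (2 * d + 1) + 1
  third-leg = begin
    4 * (suc n + d ∸ n) ∸ 1 ≡⟨ cong (λ k → 4 * (k ∸ n) ∸ 1) (+-suc n d) ⟨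
    4 * (n + suc d ∸ n) ∸ 1 ≡⟨ cong (λ k → 4 * k ∸ 1) (m+n∸m≡n n (suc d)) ⟩
    4 * suc d ∸ 1           ≡⟨ cong (_∸ 1) (four-suc d) ⟩
    2 * (2 * d + 1) + 1     ∎
    where
    open ≡-Reasoning
    four-suc : ∀ d → 4 * suc d ≡ suc (2 * (2 * d + 1) + 1)
    four-suc = solve-∀
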